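{- For any two coprime positive integers $a,b$, \[\sum_{j=0}^{a-1}\sum_{k=0}^{b-1}\left|\frac{k}{b}-\frac{j}{a}\right|=\frac{2a^2b^2-3ab+a^2+b^2-1}{6ab}.\] -}

module Defs where

open import Data.Nat using (ℕ; zero; suc)
open import Data.Rational using (ℚ; 0ℚ; _+_)

sumℚ : ℕ → (ℕ → ℚ) → ℚ
sumℚ zero    f = 0ℚ
sumℚ (suc n) f = sumℚ n f + f n

-- Put N = a·b and X j k = k·a − j·b, so that |k/b − j/a| = |X j k| / N.
-- The proof computes  S = Σ_{j<a} Σ_{k<b} |X j k|  in four steps.
--
-- For j < a, k < b let r = r(j,k) ∈ [0, N) be X j k reduced
--    modulo N; then X j k is either r or r − N, and in both cases
--        N·|X j k| = (X j k)² + r·(N − r).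
--  * Coprimality.  Since gcd(a,b) = 1, (j,k) ↦ r(j,k) is injective on
--    [0,a) × [0,b), hence a bijection onto [0,N), so Σ_{j,k} r(N − r) equals
--    Σ_{i<N} i(N − i) = (N − 1)N(N + 1)/6.
--  * Power sums.  Σ_{j,k} (X j k)² is a quadratic sum over a box, evaluated by
--    Faulhaber's formulas for Σ i and Σ i².
--  * Together: N·(6S) = N·(2a²b² − 3ab + a² + b² − 1); cancel N and divide by
--    6N to pass to the rational sum of the statement.

module Submission where

open import Data.Nat as ℕ using (ℕ; NonZero)
open import Data.Nat.Coprimality using (Coprime)
open import Data.Integer as ℤ using (ℤ; +_)
open import Relation.Binary.PropositionalEquality using (_≡_)

module IntegerSums where

  open import Data.Nat using (zero; suc; _<_)
  import Data.Nat.Properties as ℕP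
  open import Data.Integer using (0ℤ; _+_; _*_; _-_; -_)
  import Data.Integer.Properties as ℤP
  open import Data.Integer.Tactic.RingSolver using (solve-∀)
  open import Relation.Binary.PropositionalEquality using (refl; sym; trans; cong; cong₂; module ≡-Reasoning)
  open ≡-Reasoning

  Σ : ℕ → (ℕ → ℤ) → ℤ
  Σ zero    f = 0ℤ
  Σ (suc n) f = Σ n f + f n

  Σ-cong : ∀ n {f g : ℕ → ℤ} → (∀ {i} → i < n → f i ≡ g i) → Σ n f ≡ Σ n g
  Σ-cong zero    eq = refl
  Σ-cong (suc n) eq = cong₂ _+_ (Σ-cong n (λ i<n → eq (ℕP.m<n⇒m<1+n i<n))) (eq (ℕP.n<1+n n))

  Σ-+ : ∀ n (f g : ℕ → ℤ) → Σ n (λ i → f i + g i) ≡ Σ n f + Σ n g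
  Σ-+ zero    f g = refl
  Σ-+ (suc n) f g = trans (cong (_+ (f n + g n)) (Σ-+ n f g)) (interchange (Σ n f) (Σ n g) (f n) (g n))
    where
    interchange : ∀ w x y z → (w + x) + (y + z) ≡ (w + y) + (x + z)
    interchange = solve-∀

  Σ-*ˡ : ∀ n c (f : ℕ → ℤ) → Σ n (λ i → c * f i) ≡ c * Σ n f
  Σ-*ˡ zero    c f = sym (ℤP.*-zeroʳ c)
  Σ-*ˡ (suc n) c f = trans (cong (_+ c * f n) (Σ-*ˡ n c f)) (sym (ℤP.*-distribˡ-+ c (Σ n f) (f n)))

  Σ-const : ∀ n c → Σ n (λ _ → c) ≡ + n * c
  Σ-const zero    c = sym (ℤP.*-zeroˡ c)
  Σ-const (suc n) c = trans (cong (_+ c) (Σ-const n c)) (add-one (+ n) c)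
    where
    -- + suc n is definitionally + 1 + + n
    add-one : ∀ x c → x * c + c ≡ (+ 1 + x) * c
    add-one = solve-∀

  Σ-++ : ∀ m n g → Σ (m ℕ.+ n) g ≡ Σ m g + Σ n (λ i → g (m ℕ.+ i))
  Σ-++ m zero    g rewrite ℕP.+-identityʳ m = sym (ℤP.+-identityʳ (Σ m g))
  Σ-++ m (suc n) g rewrite ℕP.+-suc m n =
    trans (cong (_+ g (m ℕ.+ n)) (Σ-++ m n g)) (ℤP.+-assoc (Σ m g) _ _)

  Σ-rows : ∀ m n g → Σ (m ℕ.* n) g ≡ Σ m (λ j → Σ n (λ k → g (j ℕ.* n ℕ.+ k)))
  Σ-rows zero    n g = refl
  Σ-rows (suc m) n g = begin
    Σ (n ℕ.+ m ℕ.* n) g                               ≡⟨ cong (λ l → Σ l g) (ℕP.+-comm n (m ℕ.* n)) ⟩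
    Σ (m ℕ.* n ℕ.+ n) g                               ≡⟨ Σ-++ (m ℕ.* n) n g ⟩
    Σ (m ℕ.* n) g + Σ n (λ k → g (m ℕ.* n ℕ.+ k))     ≡⟨ cong (_+ Σ n (λ k → g (m ℕ.* n ℕ.+ k))) (Σ-rows m n g) ⟩
    Σ (suc m) (λ j → Σ n (λ k → g (j ℕ.* n ℕ.+ k)))   ∎

  S₁ S₂ : ℕ → ℤ
  S₁ n = Σ n (λ i → + i)
  S₂ n = Σ n (λ i → + i * + i)

  S₁-closed : ∀ n → + 2 * S₁ n ≡ + n * (+ n - + 1)
  S₁-closed zero    = refl
  S₁-closed (suc n) = begin
    + 2 * (S₁ n + + n)               ≡⟨ ℤP.*-distribˡ-+ (+ 2) (S₁ n) (+ n) ⟩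
    + 2 * S₁ n + + 2 * + n           ≡⟨ cong (_+ + 2 * + n) (S₁-closed n) ⟩
    + n * (+ n - + 1) + + 2 * + n    ≡⟨ step (+ n) ⟩
    + suc n * (+ suc n - + 1)        ∎
    where
    step : ∀ x → x * (x - + 1) + + 2 * x ≡ (+ 1 + x) * (+ 1 + x - + 1)
    step = solve-∀

  S₂-closed : ∀ n → + 6 * S₂ n ≡ + n * (+ n - + 1) * (+ 2 * + n - + 1)
  S₂-closed zero    = refl
  S₂-closed (suc n) = begin
    + 6 * (S₂ n + + n * + n)                                    ≡⟨ ℤP.*-distribˡ-+ (+ 6) (S₂ n) (+ n * + n) ⟩
    + 6 * S₂ n + + 6 * (+ n * + n)                              ≡⟨ cong (_+ + 6 * (+ n * + n)) (S₂-closed n) ⟩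
    + n * (+ n - + 1) * (+ 2 * + n - + 1) + + 6 * (+ n * + n)   ≡⟨ step (+ n) ⟩
    + suc n * (+ suc n - + 1) * (+ 2 * + suc n - + 1)           ∎
    where
    step : ∀ x → x * (x - + 1) * (+ 2 * x - + 1) + + 6 * (x * x)
               ≡ (+ 1 + x) * (+ 1 + x - + 1) * (+ 2 * (+ 1 + x) - + 1)
    step = solve-∀

  Σ-quadratic : ∀ n α β γ → Σ n (λ i → α * (+ i * + i) + β * + i + γ) ≡ α * S₂ n + β * S₁ n + γ * + n
  Σ-quadratic n α β γ = begin
    Σ n (λ i → α * (+ i * + i) + β * + i + γ)                ≡⟨ Σ-+ n _ _ ⟩
    Σ n (λ i → α * (+ i * + i) + β * + i) + Σ n (λ _ → γ)    ≡⟨ cong₂ _+_ (Σ-+ n _ _) (Σ-const n γ) ⟩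
    Σ n (λ i → α * (+ i * + i)) + Σ n (λ i → β * + i) + + n * γ
      ≡⟨ cong₂ (λ u v → u + v + + n * γ) (Σ-*ˡ n α _) (Σ-*ˡ n β _) ⟩
    α * S₂ n + β * S₁ n + + n * γ                            ≡⟨ cong (_+_ (α * S₂ n + β * S₁ n)) (ℤP.*-comm (+ n) γ) ⟩
    α * S₂ n + β * S₁ n + γ * + n                            ∎

  Σ-box-squares : ∀ m n p q →
    Σ m (λ j → Σ n (λ k → (+ k * p - + j * q) * (+ k * p - + j * q)))
      ≡ q * q * + n * S₂ m + (- (+ 2 * p * q * S₁ n)) * S₁ m + p * p * S₂ n * + m
  Σ-box-squares m n p q =
    trans (Σ-cong m (λ {j} _ → trans (row j) (regroup (+ j) p q (S₁ n) (S₂ n) (+ n))))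
          (Σ-quadratic m (q * q * + n) (- (+ 2 * p * q * S₁ n)) (p * p * S₂ n))
    where
    expand : ∀ k j p q → (k * p - j * q) * (k * p - j * q)
                       ≡ p * p * (k * k) + (- (+ 2 * p * q * j)) * k + q * q * (j * j)
    expand = solve-∀
    regroup : ∀ j p q s₁ s₂ n → p * p * s₂ + (- (+ 2 * p * q * j)) * s₁ + q * q * (j * j) * n
                               ≡ q * q * n * (j * j) + (- (+ 2 * p * q * s₁)) * j + p * p * s₂
    regroup = solve-∀
    row : ∀ j → Σ n (λ k → (+ k * p - + j * q) * (+ k * p - + j * q))
              ≡ p * p * S₂ n + (- (+ 2 * p * q * + j)) * S₁ n + q * q * (+ j * + j) * + n
    row j = trans (Σ-cong n (λ {k} _ → expand (+ k) (+ j) p q))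
                  (Σ-quadratic n (p * p) (- (+ 2 * p * q * + j)) (q * q * (+ j * + j)))

  Σ-box-squares-closed : ∀ m n p q →
    + 6 * Σ m (λ j → Σ n (λ k → (+ k * p - + j * q) * (+ k * p - + j * q)))
      ≡ q * q * + n * (+ m * (+ m - + 1) * (+ 2 * + m - + 1))
        - + 3 * p * q * (+ m * (+ m - + 1)) * (+ n * (+ n - + 1))
        + p * p * + m * (+ n * (+ n - + 1) * (+ 2 * + n - + 1))
  Σ-box-squares-closed m n p q = begin
    + 6 * Σ m (λ j → Σ n (λ k → (+ k * p - + j * q) * (+ k * p - + j * q)))
      ≡⟨ cong (+ 6 *_) (Σ-box-squares m n p q) ⟩
    + 6 * (q * q * + n * S₂ m + (- (+ 2 * p * q * S₁ n)) * S₁ m + p * p * S₂ n * + m)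
      ≡⟨ scale (+ m) (+ n) p q (S₁ m) (S₁ n) (S₂ m) (S₂ n) ⟩
    q * q * + n * (+ 6 * S₂ m) - + 3 * p * q * (+ 2 * S₁ m) * (+ 2 * S₁ n) + p * p * + m * (+ 6 * S₂ n)
      ≡⟨ cong₂ (λ u v → q * q * + n * u - + 3 * p * q * (+ 2 * S₁ m) * (+ 2 * S₁ n) + p * p * + m * v)
               (S₂-closed m) (S₂-closed n) ⟩
    q * q * + n * (+ m * (+ m - + 1) * (+ 2 * + m - + 1))
      - + 3 * p * q * (+ 2 * S₁ m) * (+ 2 * S₁ n)
      + p * p * + m * (+ n * (+ n - + 1) * (+ 2 * + n - + 1))
      ≡⟨ cong₂ (λ u v → q * q * + n * (+ m * (+ m - + 1) * (+ 2 * + m - + 1)) - + 3 * p * q * u * v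
                         + p * p * + m * (+ n * (+ n - + 1) * (+ 2 * + n - + 1)))
               (S₁-closed m) (S₁-closed n) ⟩
    q * q * + n * (+ m * (+ m - + 1) * (+ 2 * + m - + 1))
      - + 3 * p * q * (+ m * (+ m - + 1)) * (+ n * (+ n - + 1))
      + p * p * + m * (+ n * (+ n - + 1) * (+ 2 * + n - + 1)) ∎
    where
    scale : ∀ m n p q s₁ t₁ s₂ t₂ →
      + 6 * (q * q * n * s₂ + (- (+ 2 * p * q * t₁)) * s₁ + p * p * t₂ * m)
        ≡ q * q * n * (+ 6 * s₂) - + 3 * p * q * (+ 2 * s₁) * (+ 2 * t₁) + p * p * m * (+ 6 * t₂)
    scale = solve-∀

  Σ-complementary-products : ∀ n → + 6 * Σ n (λ i → + i * (+ n - + i)) ≡ + n * (+ n - + 1) * (+ n + + 1)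
  Σ-complementary-products n = begin
    + 6 * Σ n (λ i → + i * (+ n - + i))
      ≡⟨ cong (+ 6 *_) (trans (Σ-cong n (λ {i} _ → as-quadratic (+ i) (+ n))) (Σ-quadratic n (- + 1) (+ n) 0ℤ)) ⟩
    + 6 * ((- + 1) * S₂ n + + n * S₁ n + 0ℤ * + n)
      ≡⟨ scale (+ n) (S₁ n) (S₂ n) ⟩
    + 3 * + n * (+ 2 * S₁ n) - + 6 * S₂ n
      ≡⟨ cong₂ (λ u v → + 3 * + n * u - v) (S₁-closed n) (S₂-closed n) ⟩
    + 3 * + n * (+ n * (+ n - + 1)) - + n * (+ n - + 1) * (+ 2 * + n - + 1)
      ≡⟨ factor (+ n) ⟩
    + n * (+ n - + 1) * (+ n + + 1) ∎
    where
    as-quadratic : ∀ i n → i * (n - i) ≡ (- + 1) * (i * i) + n * i + 0ℤ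
    as-quadratic = solve-∀
    scale : ∀ n s₁ s₂ → + 6 * ((- + 1) * s₂ + n * s₁ + 0ℤ * n) ≡ + 3 * n * (+ 2 * s₁) - + 6 * s₂
    scale = solve-∀
    factor : ∀ n → + 3 * n * (n * (n - + 1)) - n * (n - + 1) * (+ 2 * n - + 1) ≡ n * (n - + 1) * (n + + 1)
    factor = solve-∀

module Representations where

  open import Data.Nat using (_*_; _+_; _<_; ∣_-_∣)
  import Data.Nat.Properties as ℕP
  open import Data.Nat.DivMod using (_%_; m<n⇒m%n≡m; %-remove-+ˡ)
  open import Data.Nat.Divisibility using (_∣_; divides; n∣m*n; n∣m⇒m%n≡0)
  open import Data.Nat.Coprimality using (coprime-divisor)
  import Data.Nat.Coprimality as Coprimality
  open import Data.Product using (_×_; _,_)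
  open import Relation.Binary.PropositionalEquality using (sym; trans; cong; cong₂; module ≡-Reasoning)
  open ≡-Reasoning

  divmod-unique : ∀ {n q q' r r'} .{{_ : NonZero n}} → r < n → r' < n →
                  q * n + r ≡ q' * n + r' → q ≡ q' × r ≡ r'
  divmod-unique {n} {q} {q'} {r} {r'} r<n r'<n eq = q≡q' , r≡r'
    where
    r≡r' : r ≡ r'
    r≡r' = begin
      r                ≡⟨ m<n⇒m%n≡m r<n ⟨
      r % n            ≡⟨ %-remove-+ˡ r (n∣m*n q) ⟨
      (q * n + r) % n  ≡⟨ cong (_% n) eq ⟩
      (q' * n + r') % n ≡⟨ %-remove-+ˡ r' (n∣m*n q') ⟩
      r' % n           ≡⟨ m<n⇒m%n≡m r'<n ⟩
      r'               ∎
    q≡q' : q ≡ q'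
    q≡q' = ℕP.*-cancelʳ-≡ q q' n (ℕP.+-cancelʳ-≡ r (q * n) (q' * n) (trans eq (cong (_+_ (q' * n)) (sym r≡r'))))

  small-multiple : ∀ {b d} .{{_ : NonZero b}} → d < b → b ∣ d → d ≡ 0
  small-multiple {b} {d} d<b b∣d = trans (sym (m<n⇒m%n≡m d<b)) (n∣m⇒m%n≡0 d b b∣d)

  distance-transfer : ∀ {x y x' y'} → x + y ≡ x' + y' → ∣ x - x' ∣ ≡ ∣ y' - y ∣
  distance-transfer {x} {y} {x'} {y'} eq = begin
    ∣ x - x' ∣                 ≡⟨ ℕP.∣m+n-m+o∣≡∣n-o∣ y x x' ⟨
    ∣ y + x - y + x' ∣         ≡⟨ cong₂ ∣_-_∣ (ℕP.+-comm y x) (ℕP.+-comm y x') ⟩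
    ∣ x + y - x' + y ∣         ≡⟨ cong (λ z → ∣ z - x' + y ∣) eq ⟩
    ∣ x' + y' - x' + y ∣       ≡⟨ ℕP.∣m+n-m+o∣≡∣n-o∣ x' y' y ⟩
    ∣ y' - y ∣                 ∎

  unique-representation : ∀ {a b k k' P Q} .{{_ : NonZero b}} → Coprime a b → k < b → k' < b →
                          k * a + P * b ≡ k' * a + Q * b → k ≡ k'
  unique-representation {a} {b} {k} {k'} {P} {Q} coprime k<b k'<b eq =
    ℕP.∣m-n∣≡0⇒m≡n (small-multiple ∣k-k'∣<b b∣∣k-k'∣)
    where
    ∣k-k'∣<b : ∣ k - k' ∣ < b
    ∣k-k'∣<b = ℕP.≤-<-trans (ℕP.∣m-n∣≤m⊔n k k') (ℕP.⊔-lub k<b k'<b)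
    -- (k − k')·a = (Q − P)·b up to sign, so b divides (k − k')·a
    multiple : a * ∣ k - k' ∣ ≡ ∣ Q - P ∣ * b
    multiple = begin
      a * ∣ k - k' ∣          ≡⟨ ℕP.*-comm a ∣ k - k' ∣ ⟩
      ∣ k - k' ∣ * a          ≡⟨ ℕP.*-distribʳ-∣-∣ a k k' ⟩
      ∣ k * a - k' * a ∣      ≡⟨ distance-transfer {k * a} {P * b} {k' * a} {Q * b} eq ⟩
      ∣ Q * b - P * b ∣       ≡⟨ ℕP.*-distribʳ-∣-∣ b Q P ⟨
      ∣ Q - P ∣ * b           ∎
    b∣∣k-k'∣ : b ∣ ∣ k - k' ∣
    b∣∣k-k'∣ = coprime-divisor (Coprimality.sym coprime) (divides ∣ Q - P ∣ multiple)

module Reindexing where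

  open import Data.Nat using (suc; _<_)
  import Data.Nat.Properties as ℕP
  open import Data.Nat.DivMod using (_/_; _%_; m≡m%n+[m/n]*n; m%n<n; m<n*o⇒m/o<n)
  open import Data.Fin as Fin using (Fin; toℕ; fromℕ<; punchOut)
  import Data.Fin.Properties as FinP
  open import Data.Fin.Permutation as Permutation using (Permutation)
  import Data.Integer.Properties as ℤP
  open import Algebra.Properties.CommutativeMonoid.Sum ℤP.+-0-commutativeMonoid
    using (sum; sum-permute; sum-cong-≗; sum-init-last)
  open import Data.Product using (∃; _×_; _,_; proj₁; proj₂)
  open import Function.Definitions using (Injective)
  open import Relation.Nullary using (yes; no)
  open import Relation.Nullary.Negation using (contradiction)
  open import Relation.Binary.PropositionalEquality
    using (_≢_; refl; sym; trans; cong; cong₂; module ≡-Reasoning)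
  open ≡-Reasoning
  open IntegerSums using (Σ; Σ-cong; Σ-rows)
  open Representations using (divmod-unique)

  Σ-as-sum : ∀ n f → Σ n f ≡ sum {n} (λ i → f (toℕ i))
  Σ-as-sum 0       f = refl
  Σ-as-sum (suc n) f = begin
    Σ n f ℤ.+ f n
      ≡⟨ cong₂ ℤ._+_ (trans (Σ-as-sum n f) (sum-cong-≗ {n} (λ i → cong f (sym (FinP.toℕ-inject₁ i)))))
                     (cong f (sym (FinP.toℕ-fromℕ n))) ⟩
    sum {n} (λ i → f (toℕ (Fin.inject₁ i))) ℤ.+ f (toℕ (Fin.fromℕ n))
      ≡⟨ sum-init-last {n} (λ i → f (toℕ i)) ⟨
    sum {suc n} (λ i → f (toℕ i)) ∎

  injective⇒surjective : ∀ {n} {f : Fin n → Fin n} → Injective _≡_ _≡_ f → ∀ y → ∃ λ x → f x ≡ y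
  injective⇒surjective {suc m} {f} f-inj y with FinP.any? (λ x → f x FinP.≟ y)
  ... | yes hit = hit
  ... | no  miss = contradiction (FinP.injective⇒≤ squeeze-inj) ℕP.1+n≰n
    where
    -- missing y, f squeezes Fin (suc m) injectively into Fin m
    avoids : ∀ x → y ≢ f x
    avoids x eq = miss (x , sym eq)
    squeeze : Fin (suc m) → Fin m
    squeeze x = punchOut (avoids x)
    squeeze-inj : Injective _≡_ _≡_ squeeze
    squeeze-inj {x} {x'} eq = f-inj (FinP.punchOut-injective (avoids x) (avoids x') eq)

  injective⇒permutation : ∀ {n} (f : Fin n → Fin n) → Injective _≡_ _≡_ f → Permutation n n
  injective⇒permutation {n} f f-inj = Permutation.permutation f preimage
    (λ y → proj₂ (injective⇒surjective f-inj y))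
    (λ x → f-inj (proj₂ (injective⇒surjective f-inj (f x))))
    where
    preimage : Fin n → Fin n
    preimage y = proj₁ (injective⇒surjective f-inj y)

  Σ-reindex : ∀ n h (σ : ℕ → ℕ) → (∀ {i} → i < n → σ i < n) →
              (∀ {i i'} → i < n → i' < n → σ i ≡ σ i' → i ≡ i') →
              Σ n (λ i → h (σ i)) ≡ Σ n h
  Σ-reindex n h σ σ< σ-inj = begin
    Σ n (λ i → h (σ i))                  ≡⟨ Σ-as-sum n (λ i → h (σ i)) ⟩
    sum {n} (λ i → h (σ (toℕ i)))        ≡⟨ sum-cong-≗ {n} (λ i → cong h (sym (FinP.toℕ-fromℕ< (σ< (FinP.toℕ<n i))))) ⟩
    sum {n} (λ i → h (toℕ (σ̂ i)))        ≡⟨ sum-permute (λ i → h (toℕ i)) (injective⇒permutation σ̂ σ̂-inj) ⟨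
    sum {n} (λ i → h (toℕ i))            ≡⟨ Σ-as-sum n h ⟨
    Σ n h                                ∎
    where
    σ̂ : Fin n → Fin n
    σ̂ i = fromℕ< (σ< (FinP.toℕ<n i))
    σ̂-inj : Injective _≡_ _≡_ σ̂
    σ̂-inj {i} {i'} eq = FinP.toℕ-injective (σ-inj (FinP.toℕ<n i) (FinP.toℕ<n i') (begin
      σ (toℕ i)     ≡⟨ FinP.toℕ-fromℕ< (σ< (FinP.toℕ<n i)) ⟨
      toℕ (σ̂ i)     ≡⟨ cong toℕ eq ⟩
      toℕ (σ̂ i')    ≡⟨ FinP.toℕ-fromℕ< (σ< (FinP.toℕ<n i')) ⟩
      σ (toℕ i')    ∎))

  Σ-reindex-box : ∀ m n .{{_ : NonZero n}} h (φ : ℕ → ℕ → ℕ) →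
    (∀ {j k} → j < m → k < n → φ j k < m ℕ.* n) →
    (∀ {j k j' k'} → j < m → k < n → j' < m → k' < n → φ j k ≡ φ j' k' → j ≡ j' × k ≡ k') →
    Σ m (λ j → Σ n (λ k → h (φ j k))) ≡ Σ (m ℕ.* n) h
  Σ-reindex-box m n h φ φ< φ-inj = begin
    Σ m (λ j → Σ n (λ k → h (φ j k)))                 ≡⟨ Σ-cong m (λ _ → Σ-cong n (λ k<n → cong h (σ-row k<n))) ⟨
    Σ m (λ j → Σ n (λ k → h (σ (j ℕ.* n ℕ.+ k))))     ≡⟨ Σ-rows m n (λ i → h (σ i)) ⟨
    Σ (m ℕ.* n) (λ i → h (σ i))                       ≡⟨ Σ-reindex (m ℕ.* n) h σ σ< σ-inj ⟩
    Σ (m ℕ.* n) h                                     ∎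
    where
    decompose : ∀ i → i ≡ i / n ℕ.* n ℕ.+ i % n
    decompose i = trans (m≡m%n+[m/n]*n i n) (ℕP.+-comm (i % n) _)
    σ : ℕ → ℕ
    σ i = φ (i / n) (i % n)
    σ-row : ∀ {j k} → k < n → σ (j ℕ.* n ℕ.+ k) ≡ φ j k
    σ-row {j} {k} k<n with divmod-unique (m%n<n (j ℕ.* n ℕ.+ k) n) k<n (sym (decompose (j ℕ.* n ℕ.+ k)))
    ... | q≡j , r≡k = cong₂ φ q≡j r≡k
    σ< : ∀ {i} → i < m ℕ.* n → σ i < m ℕ.* n
    σ< {i} i<mn = φ< (m<n*o⇒m/o<n i<mn) (m%n<n i n)
    σ-inj : ∀ {i i'} → i < m ℕ.* n → i' < m ℕ.* n → σ i ≡ σ i' → i ≡ i'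
    σ-inj {i} {i'} i<mn i'<mn eq with φ-inj (m<n*o⇒m/o<n i<mn) (m%n<n i n) (m<n*o⇒m/o<n i'<mn) (m%n<n i' n) eq
    ... | q≡q' , r≡r' = trans (decompose i) (trans (cong₂ (λ q r → q ℕ.* n ℕ.+ r) q≡q' r≡r') (sym (decompose i')))

module Differences where

  open import Data.Nat using (_<_)
  import Data.Nat.Properties as ℕP
  open import Data.Integer using (_+_; _*_; _-_; +≤+)
  import Data.Integer.Properties as ℤP
  open import Data.Integer.Tactic.RingSolver using (solve-∀)
  open import Data.Sum using (_⊎_; inj₁; inj₂)
  open import Relation.Binary.PropositionalEquality using (refl; trans; cong; module ≡-Reasoning)

  as-difference : ∀ {r y z c} → r ℕ.+ y ≡ z ℕ.+ c → + z - + y ≡ + r - + c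
  as-difference {r} {y} {z} {c} eq = begin
    + z - + y                 ≡⟨ add-subtract (+ z) (+ y) (+ c) ⟩
    + z + + c - + y - + c     ≡⟨ cong (λ t → t - + y - + c) (ℤP.pos-+ z c) ⟨
    + (z ℕ.+ c) - + y - + c   ≡⟨ cong (λ t → + t - + y - + c) eq ⟨
    + (r ℕ.+ y) - + y - + c   ≡⟨ cong (λ t → t - + y - + c) (ℤP.pos-+ r y) ⟩
    + r + + y - + y - + c     ≡⟨ cancel (+ r) (+ y) (+ c) ⟩
    + r - + c                 ∎
    where
    open ≡-Reasoning
    add-subtract : ∀ z y c → z - y ≡ z + c - y - c
    add-subtract = solve-∀
    cancel : ∀ r y c → r + y - y - c ≡ r - c
    cancel = solve-∀

  N·abs : ∀ {N r} (x : ℤ) → r < N → x ≡ + r ⊎ x ≡ + r - + N →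
          + N * + ℤ.∣ x ∣ ≡ x * x + + r * (+ N - + r)
  N·abs {N} {r} .(+ r) r<N (inj₁ refl) = nonnegative (+ r) (+ N)
    where
    nonnegative : ∀ r N → N * r ≡ r * r + r * (N - r)
    nonnegative = solve-∀
  N·abs {N} {r} .(+ r - + N) r<N (inj₂ refl) =
    trans (cong (+ N *_) (ℤP.∣-∣-≤ (+≤+ (ℕP.<⇒≤ r<N)))) (negative (+ r) (+ N))
    where
    negative : ∀ r N → N * (N - r) ≡ (r - N) * (r - N) + r * (N - r)
    negative = solve-∀

module Residues (a b : ℕ) .{{_ : NonZero a}} .{{_ : NonZero b}} (coprime : Coprime a b) where

  open import Data.Nat using (_+_; _*_; _∸_; _<_; _≤_; _≤?_)
  import Data.Nat.Properties as ℕP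
  import Data.Integer.Properties as ℤP
  open import Data.Nat.Tactic.RingSolver using (solve-∀)
  open import Data.Sum using (_⊎_; inj₁; inj₂)
  open import Data.Product using (∃; _×_; _,_; proj₂)
  open import Relation.Nullary using (yes; no)
  open import Relation.Binary.PropositionalEquality
    using (sym; trans; cong; cong₂; module ≡-Reasoning)
  open IntegerSums using (Σ)
  open Representations using (divmod-unique; unique-representation)
  open Reindexing using (Σ-reindex-box)
  open Differences using (as-difference; N·abs)

  N : ℕ
  N = a * b

  -- X j k = k·a − j·b, so that k/b − j/a = X j k / N.
  X : ℕ → ℕ → ℤ
  X j k = + k ℤ.* + a ℤ.- + j ℤ.* + b

  residue : ℕ → ℕ → ℕ
  residue j k with j * b ≤? k * a
  ... | yes _ = k * a ∸ j * b
  ... | no  _ = k * a + N ∸ j * b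

  residue-cases : ∀ j k → j < a →
    residue j k + j * b ≡ k * a ⊎ (k * a < j * b × residue j k + j * b ≡ k * a + N)
  residue-cases j k j<a with j * b ≤? k * a
  ... | yes jb≤ka = inj₁ (ℕP.m∸n+n≡m jb≤ka)
  ... | no  jb≰ka = inj₂ (ℕP.≰⇒> jb≰ka , ℕP.m∸n+n≡m jb≤ka+N)
    where
    jb≤ka+N : j * b ≤ k * a + N
    jb≤ka+N = ℕP.≤-trans (ℕP.*-monoˡ-≤ b (ℕP.<⇒≤ j<a)) (ℕP.m≤n+m N (k * a))

  residue<N : ∀ {j k} → j < a → k < b → residue j k < N
  residue<N {j} {k} j<a k<b with residue-cases j k j<a
  ... | inj₁ eq = begin-strict
    residue j k            ≤⟨ ℕP.m≤m+n (residue j k) (j * b) ⟩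
    residue j k + j * b    ≡⟨ eq ⟩
    k * a                  <⟨ ℕP.*-monoˡ-< a k<b ⟩
    b * a                  ≡⟨ ℕP.*-comm b a ⟩
    N                      ∎
    where open ℕP.≤-Reasoning
  ... | inj₂ (ka<jb , eq) = ℕP.+-cancelʳ-< (j * b) (residue j k) N (begin-strict
    residue j k + j * b    ≡⟨ eq ⟩
    k * a + N              <⟨ ℕP.+-monoˡ-< N ka<jb ⟩
    j * b + N              ≡⟨ ℕP.+-comm (j * b) N ⟩
    N + j * b              ∎)
    where open ℕP.≤-Reasoning

  residue-wraps : ∀ j k → j < a → ∃ λ w → residue j k + j * b ≡ k * a + w * N
  residue-wraps j k j<a with residue-cases j k j<a
  ... | inj₁ eq      = 0 , trans eq (sym (ℕP.+-identityʳ (k * a)))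
  ... | inj₂ (_ , eq) = 1 , trans eq (cong (_+_ (k * a)) (sym (ℕP.*-identityˡ N)))

  residue-injective : ∀ {j k j' k'} → j < a → k < b → j' < a → k' < b →
                      residue j k ≡ residue j' k' → j ≡ j' × k ≡ k'
  residue-injective {j} {k} {j'} {k'} j<a k<b j'<a k'<b r≡r'
    with w , eq ← residue-wraps j k j<a | w' , eq' ← residue-wraps j' k' j'<a =
    sym j'≡j , k≡k'
    where
    expand : ∀ k a w j b → k * a + (w * a + j) * b ≡ k * a + w * (a * b) + j * b
    expand = solve-∀
    -- both pairs represent r + j·b + j'·b
    common : k * a + (w * a + j') * b ≡ k' * a + (w' * a + j) * b
    common = begin
      k * a + (w * a + j') * b          ≡⟨ expand k a w j' b ⟩
      k * a + w * N + j' * b            ≡⟨ cong (_+ j' * b) eq ⟨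
      residue j k + j * b + j' * b      ≡⟨ ℕP.+-assoc (residue j k) (j * b) (j' * b) ⟩
      residue j k + (j * b + j' * b)    ≡⟨ cong₂ _+_ r≡r' (ℕP.+-comm (j * b) (j' * b)) ⟩
      residue j' k' + (j' * b + j * b)  ≡⟨ ℕP.+-assoc (residue j' k') (j' * b) (j * b) ⟨
      residue j' k' + j' * b + j * b    ≡⟨ cong (_+ j * b) eq' ⟩
      k' * a + w' * N + j * b           ≡⟨ expand k' a w' j b ⟨
      k' * a + (w' * a + j) * b         ∎
      where open ≡-Reasoning
    k≡k' : k ≡ k'
    k≡k' = unique-representation {P = w * a + j'} {Q = w' * a + j} coprime k<b k'<b common
    multipliers : w * a + j' ≡ w' * a + j
    multipliers = ℕP.*-cancelʳ-≡ (w * a + j') (w' * a + j) b (ℕP.+-cancelˡ-≡ (k * a) _ _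
      (trans common (cong (λ l → l * a + (w' * a + j) * b) (sym k≡k'))))
    j'≡j : j' ≡ j
    j'≡j = proj₂ (divmod-unique {q = w} {q' = w'} j'<a j<a multipliers)

  X-in-ℕ : ∀ j k → X j k ≡ + (k * a) ℤ.- + (j * b)
  X-in-ℕ j k = cong₂ ℤ._-_ (sym (ℤP.pos-* k a)) (sym (ℤP.pos-* j b))

  residue-offset : ∀ j k → j < a → X j k ≡ + residue j k ⊎ X j k ≡ + residue j k ℤ.- + N
  residue-offset j k j<a with residue-cases j k j<a
  ... | inj₁ eq       = inj₁ (trans (X-in-ℕ j k)
    (trans (as-difference {residue j k} {j * b} {k * a} {0} no-wrap) (ℤP.+-identityʳ (+ residue j k))))
    where
    no-wrap : residue j k + j * b ≡ k * a + 0
    no-wrap = trans eq (sym (ℕP.+-identityʳ (k * a)))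
  ... | inj₂ (_ , eq) = inj₂ (trans (X-in-ℕ j k) (as-difference {residue j k} {j * b} {k * a} {N} eq))

  N·|X| : ∀ {j k} → j < a → k < b →
          + N ℤ.* + ℤ.∣ X j k ∣ ≡ X j k ℤ.* X j k ℤ.+ + residue j k ℤ.* (+ N ℤ.- + residue j k)
  N·|X| {j} {k} j<a k<b = N·abs (X j k) (residue<N j<a k<b) (residue-offset j k j<a)

  Σ-residues : ∀ h → Σ a (λ j → Σ b (λ k → h (residue j k))) ≡ Σ N h
  Σ-residues h = Σ-reindex-box a b h residue residue<N residue-injective

module DistanceSum (a b : ℕ) .{{_ : NonZero a}} .{{_ : NonZero b}} (coprime : Coprime a b) where

  open import Data.Integer using (_+_; _*_; _-_)
  import Data.Integer.Properties as ℤP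
  import Data.Nat.Properties as ℕP
  open import Data.Integer.Tactic.RingSolver using (solve-∀)
  open import Relation.Binary.PropositionalEquality using (cong; cong₂; module ≡-Reasoning)
  open ≡-Reasoning
  open IntegerSums using (Σ; Σ-cong; Σ-+; Σ-*ˡ; Σ-box-squares-closed; Σ-complementary-products)
  open Residues a b coprime using (N; X; residue; N·|X|; Σ-residues)

  S : ℤ
  S = Σ a (λ j → Σ b (λ k → + ℤ.∣ X j k ∣))

  num : ℤ
  num = + 2 * + a * + a * + b * + b - + 3 * + a * + b + + a * + a + + b * + b - + 1

  squares : ℤ
  squares = Σ a (λ j → Σ b (λ k → X j k * X j k))

  complementary : ℕ → ℤ
  complementary i = + i * (+ N - + i)

  N·S : + N * S ≡ squares + Σ N complementary
  N·S = begin
    + N * S                                                       ≡⟨ Σ-*ˡ a (+ N) _ ⟨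
    Σ a (λ j → + N * Σ b (λ k → + ℤ.∣ X j k ∣))                   ≡⟨ Σ-cong a (λ _ → Σ-*ˡ b (+ N) _) ⟨
    Σ a (λ j → Σ b (λ k → + N * + ℤ.∣ X j k ∣))                   ≡⟨ Σ-cong a (λ j<a → Σ-cong b (λ k<b → N·|X| j<a k<b)) ⟩
    Σ a (λ j → Σ b (λ k → X j k * X j k + complementary (residue j k)))
                                                                  ≡⟨ Σ-cong a (λ _ → Σ-+ b _ _) ⟩
    Σ a (λ j → Σ b (λ k → X j k * X j k) + Σ b (λ k → complementary (residue j k)))
                                                                  ≡⟨ Σ-+ a _ _ ⟩
    squares + Σ a (λ j → Σ b (λ k → complementary (residue j k)))  ≡⟨ cong (_+_ squares) (Σ-residues complementary) ⟩
    squares + Σ N complementary                                    ∎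

  six-S : + 6 * S ≡ num
  six-S = ℤP.*-cancelˡ-≡ (+ N) (+ 6 * S) num {{ℕP.m*n≢0 a b}} (begin
    + N * (+ 6 * S)                          ≡⟨ swap (+ N) (+ 6) S ⟩
    + 6 * (+ N * S)                          ≡⟨ cong (+ 6 *_) N·S ⟩
    + 6 * (squares + Σ N complementary)      ≡⟨ ℤP.*-distribˡ-+ (+ 6) squares (Σ N complementary) ⟩
    + 6 * squares + + 6 * Σ N complementary
                                             ≡⟨ cong₂ _+_ (Σ-box-squares-closed a b (+ a) (+ b)) (Σ-complementary-products N) ⟩
    box (+ a) (+ b) + + N * (+ N - + 1) * (+ N + + 1)
                                             ≡⟨ cong (λ n → box (+ a) (+ b) + n * (n - + 1) * (n + + 1)) (ℤP.pos-* a b) ⟩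
    box (+ a) (+ b) + (+ a * + b) * (+ a * + b - + 1) * (+ a * + b + + 1)
                                             ≡⟨ collect (+ a) (+ b) ⟩
    + a * + b * num                          ≡⟨ cong (_* num) (ℤP.pos-* a b) ⟨
    + N * num                                ∎)
    where
    swap : ∀ x y z → x * (y * z) ≡ y * (x * z)
    swap = solve-∀
    box : ℤ → ℤ → ℤ
    box A B = B * B * B * (A * (A - + 1) * (+ 2 * A - + 1)) - + 3 * A * B * (A * (A - + 1)) * (B * (B - + 1))
              + A * A * A * (B * (B - + 1) * (+ 2 * B - + 1))
    collect : ∀ A B → B * B * B * (A * (A - + 1) * (+ 2 * A - + 1)) - + 3 * A * B * (A * (A - + 1)) * (B * (B - + 1))
                      + A * A * A * (B * (B - + 1) * (+ 2 * B - + 1)) + (A * B) * (A * B - + 1) * (A * B + + 1)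
                      ≡ A * B * (+ 2 * A * A * B * B - + 3 * A * B + A * A + B * B - + 1)
    collect = solve-∀

module RationalSums where

  open import Data.Nat using (suc; pred; _<_)
  import Data.Nat.Properties as ℕP
  open import Data.Integer using (_+_; _*_; _-_)
  import Data.Integer.Properties as ℤP
  open import Data.Integer.Tactic.RingSolver using (solve-∀)
  open import Data.Rational as ℚ using (ℚ; toℚᵘ)
  import Data.Rational.Properties as ℚP
  open import Data.Rational.Unnormalised as ℚᵘ using (mkℚᵘ; *≡*; _≃_)
  import Data.Rational.Unnormalised.Properties as ℚᵘP
  open import Relation.Binary.PropositionalEquality using (refl; sym; cong; cong₂; module ≡-Reasoning)
  open import Defs using (sumℚ)
  open IntegerSums using (Σ)

  +-common-denominator : ∀ p q d → mkℚᵘ p d ℚᵘ.+ mkℚᵘ q d ≃ mkℚᵘ (p + q) d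
  +-common-denominator p q d = *≡* (cross p q (+ suc d))
    where
    cross : ∀ p q D → (p * D + q * D) * D ≡ (p + q) * (D * D)
    cross = solve-∀

  sumℚ-common-denominator : ∀ n d (g : ℕ → ℚ) (c : ℕ → ℤ) →
    (∀ {i} → i < n → toℚᵘ (g i) ≃ mkℚᵘ (c i) d) → toℚᵘ (sumℚ n g) ≃ mkℚᵘ (Σ n c) d
  sumℚ-common-denominator 0       d g c terms = *≡* refl
  sumℚ-common-denominator (suc n) d g c terms = begin
    toℚᵘ (sumℚ n g ℚ.+ g n)                  ≈⟨ ℚP.toℚᵘ-homo-+ (sumℚ n g) (g n) ⟩
    toℚᵘ (sumℚ n g) ℚᵘ.+ toℚᵘ (g n)          ≈⟨ ℚᵘP.+-cong (sumℚ-common-denominator n d g c (λ i<n → terms (ℕP.m<n⇒m<1+n i<n)))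
                                                           (terms (ℕP.n<1+n n)) ⟩
    mkℚᵘ (Σ n c) d ℚᵘ.+ mkℚᵘ (c n) d         ≈⟨ +-common-denominator (Σ n c) (c n) d ⟩
    mkℚᵘ (Σ n c + c n) d                     ∎
    where open ℚᵘP.≃-Reasoning

  distance-of-fractions : ∀ p q m n →
    toℚᵘ (ℚ.∣ p ℚ./ suc n ℚ.- q ℚ./ suc m ∣) ≃ mkℚᵘ (+ ℤ.∣ p * + suc m - q * + suc n ∣) (pred (suc m ℕ.* suc n))
  distance-of-fractions p q m n = begin
    toℚᵘ (ℚ.∣ p/n ℚ.- q/m ∣)                     ≈⟨ ℚP.toℚᵘ-homo-∣-∣ (p/n ℚ.- q/m) ⟩
    ℚᵘ.∣ toℚᵘ (p/n ℚ.- q/m) ∣                    ≈⟨ ℚᵘP.∣-∣-cong difference ⟩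
    ℚᵘ.∣ mkℚᵘ p n ℚᵘ.- mkℚᵘ q m ∣                ≈⟨ *≡* (cong₂ (λ u v → + u * + v) (cong ℤ.∣_∣ numerator) (ℕP.*-comm (suc m) (suc n))) ⟩
    mkℚᵘ (+ ℤ.∣ p * + suc m - q * + suc n ∣) (pred (suc m ℕ.* suc n)) ∎
    where
    open ℚᵘP.≃-Reasoning
    p/n q/m : ℚ
    p/n = p ℚ./ suc n
    q/m = q ℚ./ suc m
    difference : toℚᵘ (p/n ℚ.- q/m) ≃ mkℚᵘ p n ℚᵘ.- mkℚᵘ q m
    difference = ℚᵘP.≃-trans (ℚP.toℚᵘ-homo-+ p/n (ℚ.- q/m))
      (ℚᵘP.+-cong (ℚP.toℚᵘ-fromℚᵘ (mkℚᵘ p n))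
                  (ℚᵘP.≃-trans (ℚP.toℚᵘ-homo‿- q/m) (ℚᵘP.-‿cong (ℚP.toℚᵘ-fromℚᵘ (mkℚᵘ q m)))))
    numerator : p * + suc m + ℤ.- q * + suc n ≡ p * + suc m - q * + suc n
    numerator = fold-subtraction p (+ suc m) q (+ suc n)
      where
      fold-subtraction : ∀ p m q n → p * m + ℤ.- q * n ≡ p * m - q * n
      fold-subtraction = solve-∀

  sixfold : ∀ {s t} m n → + 6 * s ≡ t → mkℚᵘ s (pred (suc m ℕ.* suc n)) ≃ mkℚᵘ t (pred (6 ℕ.* suc m ℕ.* suc n))
  sixfold {s} {t} m n 6s≡t = *≡* (begin
    s * + (6 ℕ.* suc m ℕ.* suc n)       ≡⟨ cong (s *_) (ℤP.pos-* (6 ℕ.* suc m) (suc n)) ⟩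
    s * (+ (6 ℕ.* suc m) * + suc n)     ≡⟨ cong (λ x → s * (x * + suc n)) (ℤP.pos-* 6 (suc m)) ⟩
    s * (+ 6 * + suc m * + suc n)       ≡⟨ regroup s (+ suc m) (+ suc n) ⟩
    (+ 6 * s) * (+ suc m * + suc n)     ≡⟨ cong₂ _*_ 6s≡t (sym (ℤP.pos-* (suc m) (suc n))) ⟩
    t * + (suc m ℕ.* suc n)             ∎)
    where
    open ≡-Reasoning
    regroup : ∀ s m n → s * (+ 6 * m * n) ≡ (+ 6 * s) * (m * n)
    regroup = solve-∀

open import Defs
open import Data.Rational using (_/_; ∣_∣; _-_; toℚᵘ)
open import Data.Nat.Properties using (m*n≢0)
import Data.Rational.Properties as ℚP
open import Data.Rational.Unnormalised using (mkℚᵘ)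
import Data.Rational.Unnormalised.Properties as ℚᵘP
open RationalSums using (sumℚ-common-denominator; distance-of-fractions; sixfold)

proposition3 : (a b : ℕ) → .{{_ : NonZero a}} → .{{_ : NonZero b}} → Coprime a b →
    sumℚ a (λ j → sumℚ b (λ k → ∣ (+ k) / b - (+ j) / a ∣))
      ≡ _/_ ((+ 2) ℤ.* (+ a) ℤ.* (+ a) ℤ.* (+ b) ℤ.* (+ b) ℤ.- (+ 3) ℤ.* (+ a) ℤ.* (+ b) ℤ.+ (+ a) ℤ.* (+ a) ℤ.+ (+ b) ℤ.* (+ b) ℤ.- (+ 1)) (6 ℕ.* a ℕ.* b) {{m*n≢0 (6 ℕ.* a) b {{m*n≢0 6 a}}}}
proposition3 a@(ℕ.suc m) b@(ℕ.suc n) coprime = ℚP.toℚᵘ-injective (begin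
  toℚᵘ (sumℚ a (λ j → sumℚ b (λ k → ∣ (+ k) / b - (+ j) / a ∣)))
    ≈⟨ sumℚ-common-denominator a D _ _ (λ {j} _ →
         sumℚ-common-denominator b D _ (λ k → + ℤ.∣ X j k ∣) (λ {k} _ → distance-of-fractions (+ k) (+ j) m n)) ⟩
  mkℚᵘ S D         ≈⟨ sixfold m n six-S ⟩
  mkℚᵘ num (ℕ.pred (6 ℕ.* a ℕ.* b))
                   ≈⟨ ℚP.toℚᵘ-fromℚᵘ (mkℚᵘ num (ℕ.pred (6 ℕ.* a ℕ.* b))) ⟨
  toℚᵘ (num / (6 ℕ.* a ℕ.* b)) ∎)
  where
  open ℚᵘP.≃-Reasoning
  open Residues a b coprime using (X)
  open DistanceSum a b coprime using (S; num; six-S)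
  -- mkℚᵘ p D is the fraction p / (a·b)
  D : ℕ
  D = ℕ.pred (a ℕ.* b)
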